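{- Let $c$, $k$ and $t$ be positive integers with $c\ge 3$ and $k\ge t+2$. If $c\ge 3+2\log_2 t$ or $k\ge 2t+2$, then: (i) $g(c,k,t,s+1)<g(c,k,t,s)$ for each $s\in\{t,t+1,\dots,k-2\}$; (ii) $g(c,k,t,k)<g(c,k,t,k-2)$.
   Context: For integers $t\le z\le k$, $\theta(c,k,z)=\frac{1}{(k-z)!}\prod_{i=z}^{k-1}\binom{(k-i)c}{c}$ and $g(c,k,t,z)=\theta(c,k,z)\binom{z}{t}\prod_{j=1}^{z-t}\bigl(k-(t+j-1)\bigr)$. -}

module Defs where

open import Data.Nat using (ℕ; zero; suc; _+_; _*_; _∸_; _!)
open import Data.Nat.Properties using (_!≢0)
open import Data.Nat.Combinatorics using (_C_)
open import Data.Integer using (+_)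
open import Data.Rational using (ℚ; _/_)
import Data.Rational as ℚ

prodFrom : ℕ → ℕ → (ℕ → ℕ) → ℕ
prodFrom a zero    f = 1
prodFrom a (suc n) f = f a * prodFrom (suc a) n f

-- ∏_{i=a}^{b-1} f i  (empty when b ≤ a)
prodRange : ℕ → ℕ → (ℕ → ℕ) → ℕ
prodRange a b f = prodFrom a (b ∸ a) f

θ : ℕ → ℕ → ℕ → ℚ
θ c k z = _/_ (+ prodRange z k (λ i → ((k ∸ i) * c) C c)) ((k ∸ z) !) ⦃ (k ∸ z) !≢0 ⦄

-- g(c,k,t,z) = θ(c,k,z) · C(z,t) · ∏_{j=1}^{z-t} (k - (t+j-1))
g : ℕ → ℕ → ℕ → ℕ → ℚ
g c k t z = θ c k z ℚ.* ((+ ((z C t) * prodRange 1 (suc (z ∸ t)) (λ j → k ∸ (t + j ∸ 1)))) / 1)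

module Submission where

-- Write g(c,k,t,z) = N(z) / (k - z)! with N(z) a natural number.  For t ≤ s < k the
-- definitions telescope into the exact ratio
--   N(s+1) · (s+1-t) · C((k-s)c, c) = (s+1) · (k-s) · N(s),
-- so g(s+1) < g(s) amounts to (s+1)(k-s)² < (s+1-t) C((k-s)c, c), and g(k) < g(k-2), by two
-- such steps, to 4k(k-1) < (k-t)(k-t-1) C(2c, c).  Both follow from C(nc, c) > nᶜ for n ≥ 2
-- and C(2c, c) ≥ 20 · 2^(c-3): when t² ≤ 2^(c-3) the power of 2 absorbs the factors involving t,
-- while k ≥ 2t+2 gives s+1 ≤ (k-s)(s+1-t) and k(k-1) ≤ 4(k-t)(k-t-1).

open import Defs

module Binomial where
  open import Data.Nat.Base
  open import Data.Nat.Properties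
  open import Data.Nat.Combinatorics using (_C_; nCk+nC[k+1]≡[n+1]C[k+1]; nCk≡nC[n∸k]; nC1≡n)
  open import Data.Nat.Tactic.RingSolver using (solve-∀)
  open import Algebra.Definitions.RawMagma using (_,_)
  open import Relation.Binary.PropositionalEquality

  nCk>0 : ∀ {n k} → k ≤ n → 0 < n C k
  nCk>0 {k = zero} _ = z<s
  nCk>0 {suc n} {suc k} (s≤s k≤n) = begin-strict
    0                   <⟨ nCk>0 k≤n ⟩
    n C k               ≤⟨ m≤m+n (n C k) (n C suc k) ⟩
    n C k + n C suc k   ≡⟨ nCk+nC[k+1]≡[n+1]C[k+1] n k ⟩
    suc n C suc k       ∎
    where open ≤-Reasoning

  [1+k]*[1+n]C[1+k]≡[1+n]*nCk : ∀ n k → suc k * (suc n C suc k) ≡ suc n * (n C k)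
  [1+k]*[1+n]C[1+k]≡[1+n]*nCk zero    zero    = refl
  [1+k]*[1+n]C[1+k]≡[1+n]*nCk zero    (suc k) = *-zeroʳ (2 + k)
  [1+k]*[1+n]C[1+k]≡[1+n]*nCk (suc n) zero    = begin
    1 * ((2 + n) C 1) ≡⟨ *-identityˡ _ ⟩
    (2 + n) C 1       ≡⟨ nC1≡n (2 + n) ⟩
    2 + n             ≡⟨ *-identityʳ (2 + n) ⟨
    (2 + n) * 1       ∎
    where open ≡-Reasoning
  [1+k]*[1+n]C[1+k]≡[1+n]*nCk (suc n) (suc k) = begin
    (2 + k) * ((2 + n) C (2 + k))              ≡⟨ cong ((2 + k) *_) (nCk+nC[k+1]≡[n+1]C[k+1] (suc n) (suc k)) ⟨
    (2 + k) * (X + Y)                          ≡⟨ distribute k X Y ⟩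
    (1 + k) * X + X + (2 + k) * Y              ≡⟨ cong₂ (λ p q → p + X + q) ([1+k]*[1+n]C[1+k]≡[1+n]*nCk n k)
                                                                          ([1+k]*[1+n]C[1+k]≡[1+n]*nCk n (suc k)) ⟩
    (1 + n) * (n C k) + X + (1 + n) * (n C suc k) ≡⟨ collect n (n C k) X (n C suc k) ⟩
    (1 + n) * (n C k + n C suc k) + X          ≡⟨ cong (λ p → (1 + n) * p + X) (nCk+nC[k+1]≡[n+1]C[k+1] n k) ⟩
    (1 + n) * X + X                            ≡⟨ +-comm ((1 + n) * X) X ⟩
    (2 + n) * X                                ∎
    where
    open ≡-Reasoning
    X = suc n C suc k
    Y = suc n C (2 + k)
    distribute : ∀ k X Y → (2 + k) * (X + Y) ≡ (1 + k) * X + X + (2 + k) * Y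
    distribute = solve-∀
    collect : ∀ n a X b → (1 + n) * a + X + (1 + n) * b ≡ (1 + n) * (a + b) + X
    collect = solve-∀

  [k+m]Ck≡[k+m]Cm : ∀ k m → (k + m) C k ≡ (k + m) C m
  [k+m]Ck≡[k+m]Cm k m = trans (nCk≡nC[n∸k] (m≤m+n k m)) (cong ((k + m) C_) (m+n∸m≡n k m))

  [1+k+m]Ck*[1+m]≡[1+k+m]*[k+m]Ck : ∀ k m → (suc (k + m) C k) * suc m ≡ suc (k + m) * ((k + m) C k)
  [1+k+m]Ck*[1+m]≡[1+k+m]*[k+m]Ck k m = begin
    (suc (k + m) C k) * suc m        ≡⟨ cong (λ n → (n C k) * suc m) (+-suc k m) ⟨
    ((k + suc m) C k) * suc m        ≡⟨ cong (_* suc m) ([k+m]Ck≡[k+m]Cm k (suc m)) ⟩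
    ((k + suc m) C suc m) * suc m    ≡⟨ cong (λ n → (n C suc m) * suc m) (+-suc k m) ⟩
    (suc (k + m) C suc m) * suc m    ≡⟨ *-comm (suc (k + m) C suc m) (suc m) ⟩
    suc m * (suc (k + m) C suc m)    ≡⟨ [1+k]*[1+n]C[1+k]≡[1+n]*nCk (k + m) m ⟩
    suc (k + m) * ((k + m) C m)      ≡⟨ cong (suc (k + m) *_) ([k+m]Ck≡[k+m]Cm k m) ⟨
    suc (k + m) * ((k + m) C k)      ∎
    where open ≡-Reasoning

  nCk≤[n+m]Ck : ∀ n m k → n C k ≤ (n + m) C k
  nCk≤[n+m]Ck n zero    k       = ≤-reflexive (cong (_C k) (sym (+-identityʳ n)))
  nCk≤[n+m]Ck n (suc m) zero    = ≤-refl
  nCk≤[n+m]Ck n (suc m) (suc k) = begin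
    n C suc k                               ≤⟨ nCk≤[n+m]Ck n m (suc k) ⟩
    (n + m) C suc k                         ≤⟨ m≤n+m ((n + m) C suc k) ((n + m) C k) ⟩
    (n + m) C k + (n + m) C suc k           ≡⟨ nCk+nC[k+1]≡[n+1]C[k+1] (n + m) k ⟩
    suc (n + m) C suc k                     ≡⟨ cong (_C suc k) (+-suc n m) ⟨
    (n + suc m) C suc k                     ∎
    where open ≤-Reasoning

  m*[nCk]+nC[1+k]≤[n+m]C[1+k] : ∀ n m k → m * (n C k) + n C suc k ≤ (n + m) C suc k
  m*[nCk]+nC[1+k]≤[n+m]C[1+k] n zero    k = ≤-reflexive (cong (_C suc k) (sym (+-identityʳ n)))
  m*[nCk]+nC[1+k]≤[n+m]C[1+k] n (suc m) k = begin
    n C k + m * (n C k) + n C suc k         ≡⟨ +-assoc (n C k) (m * (n C k)) (n C suc k) ⟩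
    n C k + (m * (n C k) + n C suc k)       ≤⟨ +-mono-≤ (nCk≤[n+m]Ck n m k) (m*[nCk]+nC[1+k]≤[n+m]C[1+k] n m k) ⟩
    (n + m) C k + (n + m) C suc k           ≡⟨ nCk+nC[k+1]≡[n+1]C[k+1] (n + m) k ⟩
    suc (n + m) C suc k                     ≡⟨ cong (_C suc k) (+-suc n m) ⟨
    (n + suc m) C suc k                     ∎
    where open ≤-Reasoning

  n*k+n≡n*[1+k] : ∀ n k → n * k + n ≡ n * suc k
  n*k+n≡n*[1+k] n k = trans (+-comm (n * k) n) (sym (*-suc n k))

  n^k≤[n*k]Ck : ∀ n k → n ^ k ≤ (n * k) C k
  n^k≤[n*k]Ck n zero    = ≤-refl
  n^k≤[n*k]Ck n (suc k) = begin
    n * n ^ k                               ≤⟨ *-monoʳ-≤ n (n^k≤[n*k]Ck n k) ⟩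
    n * ((n * k) C k)                       ≤⟨ m≤m+n (n * ((n * k) C k)) ((n * k) C suc k) ⟩
    n * ((n * k) C k) + (n * k) C suc k     ≤⟨ m*[nCk]+nC[1+k]≤[n+m]C[1+k] (n * k) n k ⟩
    (n * k + n) C suc k                     ≡⟨ cong (_C suc k) (n*k+n≡n*[1+k] n k) ⟩
    (n * suc k) C suc k                     ∎
    where open ≤-Reasoning

  n^[2+k]<[n*[2+k]]C[2+k] : ∀ n k → 2 ≤ n → n ^ (2 + k) < (n * (2 + k)) C (2 + k)
  n^[2+k]<[n*[2+k]]C[2+k] n k 2≤n = begin-strict
    n * n ^ (1 + k)                         <⟨ m<m+n (n * n ^ (1 + k)) (nCk>0 2+k≤x) ⟩
    n * n ^ (1 + k) + x C (2 + k)           ≤⟨ +-monoˡ-≤ (x C (2 + k)) (*-monoʳ-≤ n (n^k≤[n*k]Ck n (1 + k))) ⟩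
    n * (x C (1 + k)) + x C (2 + k)         ≤⟨ m*[nCk]+nC[1+k]≤[n+m]C[1+k] x n (1 + k) ⟩
    (x + n) C (2 + k)                       ≡⟨ cong (_C (2 + k)) (n*k+n≡n*[1+k] n (1 + k)) ⟩
    (n * (2 + k)) C (2 + k)                 ∎
    where
    open ≤-Reasoning
    x = n * (1 + k)
    2+k+k≡2*[1+k] : ∀ k → 2 + k + k ≡ 2 * (1 + k)
    2+k+k≡2*[1+k] = solve-∀
    2+k≤x : 2 + k ≤ x
    2+k≤x = ≤-trans (≤″⇒≤ (k , 2+k+k≡2*[1+k] k)) (*-monoˡ-≤ (1 + k) 2≤n)

  20*2^k≤[2*[3+k]]C[3+k] : ∀ k → 20 * 2 ^ k ≤ (2 * (3 + k)) C (3 + k)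
  20*2^k≤[2*[3+k]]C[3+k] zero    = ≤-refl
  20*2^k≤[2*[3+k]]C[3+k] (suc k) = begin
    20 * (2 * 2 ^ k)                        ≡⟨ swap 20 2 (2 ^ k) ⟩
    2 * (20 * 2 ^ k)                        ≤⟨ *-monoʳ-≤ 2 (20*2^k≤[2*[3+k]]C[3+k] k) ⟩
    2 * (x C (3 + k))                       ≤⟨ m≤m+n (2 * (x C (3 + k))) (x C (4 + k)) ⟩
    2 * (x C (3 + k)) + x C (4 + k)         ≤⟨ m*[nCk]+nC[1+k]≤[n+m]C[1+k] x 2 (3 + k) ⟩
    (x + 2) C (4 + k)                       ≡⟨ cong (_C (4 + k)) (n*k+n≡n*[1+k] 2 (3 + k)) ⟩
    (2 * (4 + k)) C (4 + k)                 ∎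
    where
    open ≤-Reasoning
    x = 2 * (3 + k)
    swap : ∀ a b c → a * (b * c) ≡ b * (a * c)
    swap = solve-∀

module Products where
  open import Data.Nat.Base
  open import Data.Nat.Properties
  open import Relation.Binary.PropositionalEquality

  m∸n≡1+o⇒n<m : ∀ {m n o} → m ∸ n ≡ suc o → n < m
  m∸n≡1+o⇒n<m m∸n≡1+o = m∸n≢0⇒n<m (λ m∸n≡0 → 0≢1+n (trans (sym m∸n≡0) m∸n≡1+o))

  m∸n≡1+o⇒m∸[1+n]≡o : ∀ {m n o} → m ∸ n ≡ suc o → m ∸ suc n ≡ o
  m∸n≡1+o⇒m∸[1+n]≡o {m} {n} m∸n≡1+o = trans (sym (pred[m∸n]≡m∸[1+n] m n)) (cong pred m∸n≡1+o)

  prodFrom-snoc : ∀ a r f → prodFrom a (suc r) f ≡ prodFrom a r f * f (a + r)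
  prodFrom-snoc a zero    f = begin
    f a * 1                                       ≡⟨ *-identityʳ (f a) ⟩
    f a                                           ≡⟨ cong f (+-identityʳ a) ⟨
    f (a + 0)                                     ≡⟨ *-identityˡ (f (a + 0)) ⟨
    1 * f (a + 0)                                 ∎
    where open ≡-Reasoning
  prodFrom-snoc a (suc r) f = begin
    f a * prodFrom (suc a) (suc r) f              ≡⟨ cong (f a *_) (prodFrom-snoc (suc a) r f) ⟩
    f a * (prodFrom (suc a) r f * f (suc a + r))  ≡⟨ *-assoc (f a) _ _ ⟨
    f a * prodFrom (suc a) r f * f (suc a + r)    ≡⟨ cong (λ i → f a * prodFrom (suc a) r f * f i) (+-suc a r) ⟨
    f a * prodFrom (suc a) r f * f (a + suc r)    ∎
    where open ≡-Reasoning

  prodFrom-pos : ∀ a r f → (∀ i → i < r → 0 < f (a + i)) → 0 < prodFrom a r f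
  prodFrom-pos a zero    f _   = z<s
  prodFrom-pos a (suc r) f f>0 = *-mono-< (subst (λ i → 0 < f i) (+-identityʳ a) (f>0 0 z<s))
    (prodFrom-pos (suc a) r f λ i i<r → subst (λ j → 0 < f j) (+-suc a i) (f>0 (suc i) (s<s i<r)))

  prodRange-uncons : ∀ a b {r} f → b ∸ a ≡ suc r → prodRange a b f ≡ f a * prodRange (suc a) b f
  prodRange-uncons a b {r} f b∸a≡1+r = begin
    prodFrom a (b ∸ a) f                      ≡⟨ cong (λ n → prodFrom a n f) b∸a≡1+r ⟩
    f a * prodFrom (suc a) r f                ≡⟨ cong (λ n → f a * prodFrom (suc a) n f) b∸[1+a]≡r ⟨
    f a * prodFrom (suc a) (b ∸ suc a) f      ∎
    where
    open ≡-Reasoning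
    b∸[1+a]≡r : b ∸ suc a ≡ r
    b∸[1+a]≡r = m∸n≡1+o⇒m∸[1+n]≡o {b} {a} b∸a≡1+r

module Estimates where
  open import Data.Nat.Base
  open import Data.Nat.Properties
  open import Data.Nat.Combinatorics using (_C_)
  open import Data.Nat.Tactic.RingSolver using (solve-∀)
  open import Algebra.Definitions.RawMagma using (_,_)
  open import Data.Sum.Base using (_⊎_; inj₁; inj₂)
  open import Relation.Binary.PropositionalEquality
  open Binomial

  1+t+b≤2*t*t*[1+b] : ∀ t b → 1 ≤ t → suc (t + b) ≤ 2 * (t * t) * suc b
  1+t+b≤2*t*t*[1+b] (suc t) b _ = ≤″⇒≤ (_ , expand t b)
    where
    expand : ∀ t b → suc (suc t + b) + (2 * t * t * b + 2 * t * t + 4 * t * b + 3 * t + b)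
                     ≡ 2 * (suc t * suc t) * suc b
    expand = solve-∀

  1+t+b≤[1+b]*[2+a]^[1+e] : ∀ t b a e → 1 ≤ t → (t * t ≤ 2 ^ e ⊎ t ≤ a + b) →
    suc (t + b) ≤ suc b * (2 + a) ^ (1 + e)
  1+t+b≤[1+b]*[2+a]^[1+e] t b a e 1≤t (inj₁ t*t≤2^e) = begin
    suc (t + b)                 ≤⟨ 1+t+b≤2*t*t*[1+b] t b 1≤t ⟩
    2 * (t * t) * suc b         ≤⟨ *-monoˡ-≤ (suc b) (*-monoʳ-≤ 2 t*t≤2^e) ⟩
    2 ^ (1 + e) * suc b         ≤⟨ *-monoˡ-≤ (suc b) (^-monoˡ-≤ (1 + e) (s≤s (s≤s z≤n))) ⟩
    (2 + a) ^ (1 + e) * suc b   ≡⟨ *-comm ((2 + a) ^ (1 + e)) (suc b) ⟩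
    suc b * (2 + a) ^ (1 + e)   ∎
    where open ≤-Reasoning
  1+t+b≤[1+b]*[2+a]^[1+e] t b a e _ (inj₂ t≤a+b) = begin
    suc (t + b)                 ≤⟨ s≤s (+-monoˡ-≤ b t≤a+b) ⟩
    suc (a + b + b)             ≤⟨ ≤″⇒≤ (_ , expand a b) ⟩
    suc b * (2 + a)             ≤⟨ *-monoʳ-≤ (suc b) (m≤m*n (2 + a) ((2 + a) ^ e) {{m^n≢0 (2 + a) e}}) ⟩
    suc b * (2 + a) ^ (1 + e)   ∎
    where
    open ≤-Reasoning
    expand : ∀ a b → suc (a + b + b) + (1 + a * b) ≡ suc b * (2 + a)
    expand = solve-∀

  step-bound : ∀ t b a e → 1 ≤ t → (t * t ≤ 2 ^ e ⊎ t ≤ a + b) →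
    suc (t + b) * (2 + a) * (2 + a) < suc b * (((2 + a) * (3 + e)) C (3 + e))
  step-bound t b a e 1≤t cond = begin-strict
    suc (t + b) * n * n               ≤⟨ *-monoˡ-≤ n (*-monoˡ-≤ n (1+t+b≤[1+b]*[2+a]^[1+e] t b a e 1≤t cond)) ⟩
    suc b * (n * n ^ e) * n * n       ≡⟨ regroup (suc b) n (n ^ e) ⟩
    suc b * n ^ (3 + e)               <⟨ *-monoʳ-< (suc b) (n^[2+k]<[n*[2+k]]C[2+k] n (1 + e) (s≤s (s≤s z≤n))) ⟩
    suc b * ((n * (3 + e)) C (3 + e)) ∎
    where
    open ≤-Reasoning
    n = 2 + a
    regroup : ∀ x n p → x * (n * p) * n * n ≡ x * (n * (n * (n * p)))
    regroup = solve-∀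

  4*[2+t+a]*[1+t+a]<20*2^e*[2+a]*[1+a] : ∀ t a e → 1 ≤ t → (t * t ≤ 2 ^ e ⊎ t ≤ a) →
    4 * ((2 + (t + a)) * (1 + (t + a))) < 20 * 2 ^ e * ((2 + a) * (1 + a))
  4*[2+t+a]*[1+t+a]<20*2^e*[2+a]*[1+a] (suc t) a e _ (inj₁ t*t≤2^e) = begin-strict
    4 * ((2 + (suc t + a)) * (1 + (suc t + a)))   ≤⟨ *-monoʳ-≤ 4 (*-mono-≤ 2+t+a≤3*t*[1+a] 1+t+a≤t*[2+a]) ⟩
    4 * (3 * suc t * (1 + a) * (suc t * (2 + a))) ≡⟨ regroup (suc t) a ⟩
    12 * (suc t * suc t * P)                      <⟨ *-monoˡ-< (suc t * suc t * P) (m<m+n 12 {8} z<s) ⟩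
    20 * (suc t * suc t * P)                      ≡⟨ *-assoc 20 (suc t * suc t) P ⟨
    20 * (suc t * suc t) * P                      ≤⟨ *-monoˡ-≤ P (*-monoʳ-≤ 20 t*t≤2^e) ⟩
    20 * 2 ^ e * P                                ∎
    where
    open ≤-Reasoning
    P = (2 + a) * (1 + a)
    expand₁ : ∀ t a → 2 + (suc t + a) + (2 * a + 2 * t + 3 * t * a) ≡ 3 * suc t * (1 + a)
    expand₁ = solve-∀
    2+t+a≤3*t*[1+a] : 2 + (suc t + a) ≤ 3 * suc t * (1 + a)
    2+t+a≤3*t*[1+a] = ≤″⇒≤ (_ , expand₁ t a)
    expand₂ : ∀ t a → 1 + (suc t + a) + (t + t * a) ≡ suc t * (2 + a)
    expand₂ = solve-∀
    1+t+a≤t*[2+a] : 1 + (suc t + a) ≤ suc t * (2 + a)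
    1+t+a≤t*[2+a] = ≤″⇒≤ (_ , expand₂ t a)
    regroup : ∀ t a → 4 * (3 * t * (1 + a) * (t * (2 + a))) ≡ 12 * (t * t * ((2 + a) * (1 + a)))
    regroup = solve-∀
  4*[2+t+a]*[1+t+a]<20*2^e*[2+a]*[1+a] t a e _ (inj₂ t≤a) = begin-strict
    4 * ((2 + (t + a)) * (1 + (t + a)))           ≤⟨ *-monoʳ-≤ 4 (*-mono-≤ (+-monoʳ-≤ 2 t+a≤a+a) (+-monoʳ-≤ 1 t+a≤a+a)) ⟩
    4 * ((2 + (a + a)) * (1 + (a + a)))           <⟨ ≤″⇒≤ (_ , expand a) ⟩
    20 * P                                        ≤⟨ *-monoˡ-≤ P (*-monoʳ-≤ 20 (m^n>0 2 e)) ⟩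
    20 * 2 ^ e * P                                ∎
    where
    open ≤-Reasoning
    P = (2 + a) * (1 + a)
    t+a≤a+a = +-monoˡ-≤ a t≤a
    expand : ∀ a → suc (4 * ((2 + (a + a)) * (1 + (a + a)))) + (31 + 36 * a + 4 * a * a)
                   ≡ 20 * ((2 + a) * (1 + a))
    expand = solve-∀

  last-bound : ∀ t a e → 1 ≤ t → (t * t ≤ 2 ^ e ⊎ t ≤ a) →
    4 * ((2 + (t + a)) * (1 + (t + a))) < (2 + a) * (1 + a) * ((2 * (3 + e)) C (3 + e))
  last-bound t a e 1≤t cond = begin-strict
    4 * ((2 + (t + a)) * (1 + (t + a)))           <⟨ 4*[2+t+a]*[1+t+a]<20*2^e*[2+a]*[1+a] t a e 1≤t cond ⟩
    20 * 2 ^ e * P                                ≡⟨ *-comm (20 * 2 ^ e) P ⟩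
    P * (20 * 2 ^ e)                              ≤⟨ *-monoʳ-≤ P (20*2^k≤[2*[3+k]]C[3+k] e) ⟩
    P * ((2 * (3 + e)) C (3 + e))                 ∎
    where
    open ≤-Reasoning
    P = (2 + a) * (1 + a)

  2*t+2≤t+m+2⇒t≤m : ∀ t m → 2 * t + 2 ≤ t + m + 2 → t ≤ m
  2*t+2≤t+m+2⇒t≤m t m le =
    subst (_≤ m) (+-identityʳ t) (+-cancelˡ-≤ t (t + 0) m (+-cancelʳ-≤ 2 (2 * t) (t + m) le))

  x*a≡b*y⇒b*m<a⇒x*m<y : ∀ {x y a b m} → x * a ≡ b * y → b * m < a → 0 < y → x * m < y
  x*a≡b*y⇒b*m<a⇒x*m<y {x} {y} {a} {b} {m} x*a≡b*y b*m<a y>0 = *-cancelʳ-< a (x * m) y (begin-strict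
    x * m * a   ≡⟨ swap x m a ⟩
    x * a * m   ≡⟨ cong (_* m) x*a≡b*y ⟩
    b * y * m   ≡⟨ swap b y m ⟩
    b * m * y   <⟨ *-monoˡ-< y {{>-nonZero y>0}} b*m<a ⟩
    a * y       ≡⟨ *-comm a y ⟩
    y * a       ∎)
    where
    open ≤-Reasoning
    swap : ∀ x y z → x * y * z ≡ x * z * y
    swap = solve-∀

module Monotonicity where
  open import Data.Nat.Base hiding (_/_)
  open import Data.Nat.Properties
  open import Data.Nat.Combinatorics using (_C_; nCn≡1)
  open import Data.Nat.Tactic.RingSolver using (solve-∀)
  open import Data.Integer.Base as ℤ using (+_; +<+)
  open import Data.Integer.Properties using (pos-*)
  open import Data.Rational.Base as ℚ using (_/_; toℚᵘ)
  open import Data.Rational.Properties using (toℚᵘ-cancel-<; toℚᵘ-homo-*; toℚᵘ-fromℚᵘ)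
  open import Data.Rational.Unnormalised.Base as ℚᵘ using (mkℚᵘ; *<*)
  import Data.Rational.Unnormalised.Properties as ℚᵘ
  open import Data.Sum.Base using (_⊎_; map₂)
  open import Function.Base using (_∘_)
  open import Relation.Binary.PropositionalEquality
  open Binomial
  open Products
  open Estimates

  [a/m]*b<[c/n]*d : ∀ a b c d m n .{{_ : NonZero m}} .{{_ : NonZero n}} →
    a * b * n < c * d * m → (+ a / m) ℚ.* (+ b / 1) ℚ.< (+ c / n) ℚ.* (+ d / 1)
  [a/m]*b<[c/n]*d a b c d m@(suc m-1) n@(suc n-1) ab*n<cd*m = toℚᵘ-cancel-< (begin-strict
    toℚᵘ ((+ a / m) ℚ.* (+ b / 1))         ≃⟨ toℚᵘ-homo-* (+ a / m) (+ b / 1) ⟩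
    toℚᵘ (+ a / m) ℚᵘ.* toℚᵘ (+ b / 1)     ≃⟨ ℚᵘ.*-cong (toℚᵘ-/ a m-1) (toℚᵘ-/ b 0) ⟩
    mkℚᵘ (+ a) m-1 ℚᵘ.* mkℚᵘ (+ b) 0       <⟨ *<* (subst₂ ℤ._<_ (lift a b n) (lift c d m) (+<+ ab*n<cd*m)) ⟩
    mkℚᵘ (+ c) n-1 ℚᵘ.* mkℚᵘ (+ d) 0       ≃⟨ ℚᵘ.*-cong (toℚᵘ-/ c n-1) (toℚᵘ-/ d 0) ⟨
    toℚᵘ (+ c / n) ℚᵘ.* toℚᵘ (+ d / 1)     ≃⟨ toℚᵘ-homo-* (+ c / n) (+ d / 1) ⟨
    toℚᵘ ((+ c / n) ℚ.* (+ d / 1))         ∎)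
    where
    open ℚᵘ.≤-Reasoning
    toℚᵘ-/ : ∀ x d → toℚᵘ (+ x / suc d) ℚᵘ.≃ mkℚᵘ (+ x) d
    toℚᵘ-/ x d = toℚᵘ-fromℚᵘ (mkℚᵘ (+ x) d)
    lift : ∀ x y z → + (x * y * z) ≡ + x ℤ.* + y ℤ.* + (z * 1)
    lift x y z = trans (cong (λ w → + (x * y * w)) (sym (*-identityʳ z)))
      (trans (pos-* (x * y) (z * 1)) (cong (ℤ._* + (z * 1)) (pos-* x y)))

  θNumerator : ℕ → ℕ → ℕ → ℕ
  θNumerator c k z = prodRange z k (λ i → ((k ∸ i) * c) C c)

  gFactor : ℕ → ℕ → ℕ → ℕ
  gFactor k t z = (z C t) * prodRange 1 (suc (z ∸ t)) (λ j → k ∸ (t + j ∸ 1))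

  -- g c k t z ≡ gNumerator c k t z / (k ∸ z) !
  gNumerator : ℕ → ℕ → ℕ → ℕ → ℕ
  gNumerator c k t z = θNumerator c k z * gFactor k t z

  g-< : ∀ c k t z₁ z₂ → gNumerator c k t z₁ * (k ∸ z₂) ! < gNumerator c k t z₂ * (k ∸ z₁) ! →
    g c k t z₁ ℚ.< g c k t z₂
  g-< c k t z₁ z₂ = [a/m]*b<[c/n]*d (θNumerator c k z₁) (gFactor k t z₁) (θNumerator c k z₂) (gFactor k t z₂)
    ((k ∸ z₁) !) ((k ∸ z₂) !) {{(k ∸ z₁) !≢0}} {{(k ∸ z₂) !≢0}}

  gNumerator-pos : ∀ c k t z → t ≤ z → z ≤ k → 0 < gNumerator c k t z
  gNumerator-pos c k t z t≤z z≤k = *-mono-< θ>0 (*-mono-< (nCk>0 t≤z) falling>0)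
    where
    θ>0 : 0 < θNumerator c k z
    θ>0 = prodFrom-pos z (k ∸ z) _ λ i i<k∸z →
      let z+i<k = subst (z + i <_) (m+[n∸m]≡n z≤k) (+-monoʳ-< z i<k∸z)
      in nCk>0 (m≤n*m c (k ∸ (z + i)) {{>-nonZero (m<n⇒0<n∸m z+i<k)}})
    falling>0 : 0 < prodFrom 1 (z ∸ t) (λ j → k ∸ (t + j ∸ 1))
    falling>0 = prodFrom-pos 1 (z ∸ t) _ λ i i<z∸t →
      let t+i<k = <-≤-trans (subst (t + i <_) (m+[n∸m]≡n t≤z) (+-monoʳ-< t i<z∸t)) z≤k
      in subst (λ x → 0 < k ∸ (x ∸ 1)) (sym (+-suc t i)) (m<n⇒0<n∸m t+i<k)

  gNumerator-step : ∀ c k t b {s n} → t + b ≡ s → k ∸ s ≡ suc n →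
    gNumerator c k t (suc s) * (suc b * ((suc n * c) C c)) ≡ suc s * suc n * gNumerator c k t s
  gNumerator-step c k t b {n = n} refl k∸s≡1+n = begin
    θ₁ * (C₁ * P₁) * (suc b * G)              ≡⟨ cong (λ p → θ₁ * (C₁ * p) * (suc b * G)) falling-snoc ⟩
    θ₁ * (C₁ * (P₀ * suc n)) * (suc b * G)    ≡⟨ regroup θ₁ C₁ P₀ (suc n) (suc b) G ⟩
    C₁ * suc b * suc n * (G * θ₁) * P₀        ≡⟨ cong₂ (λ x y → x * suc n * y * P₀) C-absorb (sym θ-uncons) ⟩
    suc s * C₀ * suc n * θ₀ * P₀              ≡⟨ regroup′ (suc s) C₀ (suc n) θ₀ P₀ ⟩
    suc s * suc n * (θ₀ * (C₀ * P₀))          ∎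
    where
    open ≡-Reasoning
    s = t + b
    h = λ j → k ∸ (t + j ∸ 1)
    θ₀ = θNumerator c k s
    θ₁ = θNumerator c k (suc s)
    C₀ = s C t
    C₁ = suc s C t
    P₀ = prodFrom 1 (s ∸ t) h
    P₁ = prodFrom 1 (suc s ∸ t) h
    G = (suc n * c) C c
    C-absorb : C₁ * suc b ≡ suc s * C₀
    C-absorb = [1+k+m]Ck*[1+m]≡[1+k+m]*[k+m]Ck t b
    θ-uncons : θ₀ ≡ G * θ₁
    θ-uncons = trans (prodRange-uncons s k (λ i → ((k ∸ i) * c) C c) k∸s≡1+n)
                     (cong (λ x → ((x * c) C c) * θ₁) k∸s≡1+n)
    1+s∸t≡1+b : suc s ∸ t ≡ suc b
    1+s∸t≡1+b = trans (cong (_∸ t) (sym (+-suc t b))) (m+n∸m≡n t (suc b))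
    falling-snoc : P₁ ≡ P₀ * suc n
    falling-snoc = begin
      prodFrom 1 (suc s ∸ t) h        ≡⟨ cong (λ r → prodFrom 1 r h) 1+s∸t≡1+b ⟩
      prodFrom 1 (suc b) h            ≡⟨ prodFrom-snoc 1 b h ⟩
      prodFrom 1 b h * h (1 + b)      ≡⟨ cong₂ (λ r x → prodFrom 1 r h * (k ∸ (x ∸ 1))) (m+n∸m≡n t b) (sym (+-suc t b)) ⟨
      P₀ * (k ∸ s)                    ≡⟨ cong (P₀ *_) k∸s≡1+n ⟩
      P₀ * suc n                      ∎
    regroup : ∀ θ C P n b G → θ * (C * (P * n)) * (b * G) ≡ C * b * n * (G * θ) * P
    regroup = solve-∀
    regroup′ : ∀ s C n θ P → s * C * n * θ * P ≡ s * n * (θ * (C * P))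
    regroup′ = solve-∀

  g-suc-< : ∀ c k t b {s n} → t + b ≡ s → k ∸ s ≡ suc n →
    suc (t + b) * suc n * suc n < suc b * ((suc n * c) C c) → g c k t (suc s) ℚ.< g c k t s
  g-suc-< c k t b {n = n} refl k∸s≡1+n ratio-bound = g-< c k t (suc s) s (begin-strict
    N₁ * (k ∸ s) !        ≡⟨ cong (N₁ *_) (trans (cong _! k∸s≡1+n) (cong (λ x → suc n * x !) (sym k∸[1+s]≡n))) ⟩
    N₁ * (suc n * F)      ≡⟨ *-assoc N₁ (suc n) F ⟨
    N₁ * suc n * F        <⟨ *-monoˡ-< F {{(k ∸ suc s) !≢0}} N₁*[1+n]<N₀ ⟩
    N₀ * F                ∎)
    where
    open ≤-Reasoning
    s = t + b
    N₀ = gNumerator c k t s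
    N₁ = gNumerator c k t (suc s)
    F = (k ∸ suc s) !
    k∸[1+s]≡n : k ∸ suc s ≡ n
    k∸[1+s]≡n = m∸n≡1+o⇒m∸[1+n]≡o {k} {s} k∸s≡1+n
    N₀>0 : 0 < N₀
    N₀>0 = gNumerator-pos c k t s (m≤m+n t b) (<⇒≤ (m∸n≡1+o⇒n<m {k} {s} k∸s≡1+n))
    N₁*[1+n]<N₀ : N₁ * suc n < N₀
    N₁*[1+n]<N₀ = x*a≡b*y⇒b*m<a⇒x*m<y {N₁} {N₀} {suc b * ((suc n * c) C c)} {suc s * suc n}
      (gNumerator-step c k t b refl k∸s≡1+n) ratio-bound N₀>0

  g-last-< : ∀ c t a → 4 * ((2 + (t + a)) * (1 + (t + a))) < (2 + a) * (1 + a) * ((2 * c) C c) →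
    g c (2 + (t + a)) t (2 + (t + a)) ℚ.< g c (2 + (t + a)) t (t + a)
  g-last-< c t a bound = g-< c k t k u (begin-strict
    N₂ * (k ∸ u) !        ≡⟨ cong (λ x → N₂ * x !) (m+n∸n≡m 2 u) ⟩
    N₂ * 2                <⟨ N₂*2<N₀ ⟩
    N₀                    ≡⟨ *-identityʳ N₀ ⟨
    N₀ * 1                ≡⟨ cong (λ x → N₀ * x !) (n∸n≡0 k) ⟨
    N₀ * (k ∸ k) !        ∎)
    where
    open ≤-Reasoning
    u = t + a
    k = 2 + u
    N₀ = gNumerator c k t u
    N₁ = gNumerator c k t (suc u)
    N₂ = gNumerator c k t k
    G = (2 * c) C c
    N₂*[2+a]≡k*N₁ : N₂ * (2 + a) ≡ k * N₁
    N₂*[2+a]≡k*N₁ = begin-equality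
      N₂ * (2 + a)                      ≡⟨ cong (N₂ *_) (*-identityʳ (2 + a)) ⟨
      N₂ * ((2 + a) * 1)                ≡⟨ cong (λ x → N₂ * ((2 + a) * x)) (trans (cong (_C c) (*-identityˡ c)) (nCn≡1 c)) ⟨
      N₂ * ((2 + a) * ((1 * c) C c))    ≡⟨ gNumerator-step c k t (suc a) (+-suc t a) (m+n∸n≡m 1 u) ⟩
      k * 1 * N₁                        ≡⟨ cong (_* N₁) (*-identityʳ k) ⟩
      k * N₁                            ∎
    N₂*[2+a]*[1+a]*G≡k*[1+u]*2*N₀ : N₂ * ((2 + a) * ((1 + a) * G)) ≡ k * ((1 + u) * 2) * N₀
    N₂*[2+a]*[1+a]*G≡k*[1+u]*2*N₀ = begin-equality
      N₂ * ((2 + a) * ((1 + a) * G))    ≡⟨ *-assoc N₂ (2 + a) ((1 + a) * G) ⟨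
      N₂ * (2 + a) * ((1 + a) * G)      ≡⟨ cong (_* ((1 + a) * G)) N₂*[2+a]≡k*N₁ ⟩
      k * N₁ * ((1 + a) * G)            ≡⟨ *-assoc k N₁ ((1 + a) * G) ⟩
      k * (N₁ * ((1 + a) * G))          ≡⟨ cong (k *_) (gNumerator-step c k t a refl (m+n∸n≡m 2 u)) ⟩
      k * ((1 + u) * 2 * N₀)            ≡⟨ *-assoc k ((1 + u) * 2) N₀ ⟨
      k * ((1 + u) * 2) * N₀            ∎
    regroup : ∀ x y → 4 * (x * y) ≡ x * (y * 2) * 2
    regroup = solve-∀
    bound′ : k * ((1 + u) * 2) * 2 < (2 + a) * ((1 + a) * G)
    bound′ = subst₂ _<_ (regroup k (1 + u)) (*-assoc (2 + a) (1 + a) G) bound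
    N₀>0 : 0 < N₀
    N₀>0 = gNumerator-pos c k t u (m≤m+n t a) (≤-trans (n≤1+n u) (n≤1+n (suc u)))
    N₂*2<N₀ : N₂ * 2 < N₀
    N₂*2<N₀ = x*a≡b*y⇒b*m<a⇒x*m<y {N₂} {N₀} {(2 + a) * ((1 + a) * G)} {k * ((1 + u) * 2)}
      N₂*[2+a]*[1+a]*G≡k*[1+u]*2*N₀ bound′ N₀>0

  g-decreasing : ∀ e k t s → 1 ≤ t → (t * t ≤ 2 ^ e ⊎ k ≥ 2 * t + 2) → k ≥ t + 2 →
    t ≤ s → s ≤ k ∸ 2 → g (3 + e) k t (suc s) ℚ.< g (3 + e) k t s
  g-decreasing e k t s 1≤t cond k≥t+2 t≤s s≤k∸2 =
    g-suc-< (3 + e) k t b t+b≡s k∸s≡2+a (step-bound t b a e 1≤t (map₂ t≤a+b cond))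
    where
    b = s ∸ t
    t+b≡s = m+[n∸m]≡n t≤s
    a = k ∸ (s + 2)
    s+2+a≡k = m+[n∸m]≡n (m≤o∸n⇒m+n≤o s (m+n≤o⇒n≤o t k≥t+2) s≤k∸2)
    k∸s≡2+a : k ∸ s ≡ 2 + a
    k∸s≡2+a = trans (cong (_∸ s) (trans (sym s+2+a≡k) (+-assoc s 2 a))) (m+n∸m≡n s (2 + a))
    rearrange : ∀ t b a → t + b + 2 + a ≡ t + (a + b) + 2
    rearrange = solve-∀
    k≡t+[a+b]+2 : k ≡ t + (a + b) + 2
    k≡t+[a+b]+2 = trans (sym s+2+a≡k) (trans (cong (λ x → x + 2 + a) (sym t+b≡s)) (rearrange t b a))
    t≤a+b : 2 * t + 2 ≤ k → t ≤ a + b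
    t≤a+b = 2*t+2≤t+m+2⇒t≤m t (a + b) ∘ subst (2 * t + 2 ≤_) k≡t+[a+b]+2

  g-last-decreasing : ∀ e k t → 1 ≤ t → (t * t ≤ 2 ^ e ⊎ k ≥ 2 * t + 2) → k ≥ t + 2 →
    g (3 + e) k t k ℚ.< g (3 + e) k t (k ∸ 2)
  g-last-decreasing e k t 1≤t cond k≥t+2 =
    subst (λ k → g (3 + e) k t k ℚ.< g (3 + e) k t (k ∸ 2)) 2+[t+a]≡k
      (g-last-< (3 + e) t a (last-bound t a e 1≤t (map₂ t≤a cond)))
    where
    a = k ∸ (t + 2)
    rearrange : ∀ t a → 2 + (t + a) ≡ t + 2 + a
    rearrange = solve-∀
    2+[t+a]≡k : 2 + (t + a) ≡ k
    2+[t+a]≡k = trans (rearrange t a) (m+[n∸m]≡n k≥t+2)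
    t≤a : 2 * t + 2 ≤ k → t ≤ a
    t≤a = 2*t+2≤t+m+2⇒t≤m t a ∘ subst (2 * t + 2 ≤_) (trans (sym 2+[t+a]≡k) (+-comm 2 (t + a)))

open import Data.Nat using (ℕ; suc; _+_; _*_; _∸_; _^_; _≤_; _≥_; s≤s; z≤n)
open import Data.Product using (_×_; _,_)
open import Data.Sum using (_⊎_)
open import Data.Rational using (_<_)
open Monotonicity using (g-decreasing; g-last-decreasing)

lemma6p1 : (c k t : ℕ) → 1 ≤ c → 1 ≤ t → c ≥ 3 → k ≥ t + 2 →
    (t * t ≤ 2 ^ (c ∸ 3) ⊎ k ≥ 2 * t + 2) →
    ((s : ℕ) → t ≤ s → s ≤ k ∸ 2 → g c k t (suc s) < g c k t s)
    × (g c k t k < g c k t (k ∸ 2))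
lemma6p1 (suc (suc (suc e))) k t _ 1≤t (s≤s (s≤s (s≤s z≤n))) k≥t+2 cond =
  (λ s → g-decreasing e k t s 1≤t cond k≥t+2) , g-last-decreasing e k t 1≤t cond k≥t+2
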